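{- For all matches $(p,\sigma)$ and $(q,\rho)$ of CPC patterns, if $p,\sigma\bowtie q,\rho$, then for every substitution $\theta$ there exist substitutions $\sigma'$ and $\rho'$ such that $\theta p,\sigma'\bowtie\theta q,\rho'$.
   Context: Patterns: $p ::= \lambda x \mid x \mid \ulcorner x\urcorner \mid p\bullet p$ (binding, variable, protected name, compound); ${\sf vn},{\sf pn},{\sf bn}$ are variable, protected, binding names, ${\sf fn}={\sf vn}\cup{\sf pn}$; patterns are well formed (binding names distinct, disjoint from free names). Communicable patterns contain no protected or binding names; $\ulcorner p\bullet q\urcorner=\ulcorner p\urcorner\bullet\ulcorner q\urcorner$ for communicable patterns. A substitution is a finite-domain partial map from names to communicable patterns. On patterns: $\sigma x=\sigma(x)$ if $x\in{\sf dom}(\sigma)$ else $x$; $\sigma\ulcorner x\urcorner=\ulcorner\sigma(x)\urcorner$ if $x\in{\sf dom}(\sigma)$ else $\ulcorner x\urcorner$; $\sigma(\lambda x)=\lambda x$; $\sigma(p\bullet q)=\sigma p\bullet\sigma q$. $\hat\sigma$: $\hat\sigma x=x$, $\hat\sigma\ulcorner x\urcorner=\ulcorner x\urcorner$, $\hat\sigma(\lambda x)=\sigma(x)$ if $x\in{\sf dom}(\sigma)$ else $\lambda x$, $\hat\sigma(p\bullet q)=\hat\sigma p\bullet\hat\sigma q$. A match $(p,\sigma)$: ${\sf bn}(p)={\sf dom}(\sigma)$. Compatibility $p,\sigma\bowtie q,\rho$ between matches is defined inductively: $p,\sigma\bowtie\lambda y,\{\hat\sigma p/y\}$ if ${\sf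 fn}(p)=\emptyset$; $n,\{\}\bowtie n,\{\}$; $\ulcorner n\urcorner,\{\}\bowtie\ulcorner n\urcorner,\{\}$; $\ulcorner n\urcorner,\{\}\bowtie n,\{\}$; $p_1\bullet p_2,\sigma_1\cup\sigma_2\bowtie q_1\bullet q_2,\rho_1\cup\rho_2$ if $p_i,\sigma_i\bowtie q_i,\rho_i$ for $i=1,2$. -}

module Defs where

open import Data.Nat using (ℕ; _≟_)
open import Data.List using (List; []; _∷_; _++_)
open import Data.List.Membership.Propositional using (_∈_; _∉_)
open import Data.List.Relation.Unary.Unique.Propositional using (Unique)
open import Data.Maybe using (Maybe; just; nothing; is-just)
open import Data.Maybe.Relation.Unary.Any using () renaming (Any to MaybeAny)
open import Data.Bool using (true)
open import Data.Product using (Σ; ∃; _×_)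
open import Data.Unit using (⊤)
open import Relation.Nullary using (yes; no)
open import Relation.Binary.PropositionalEquality using (_≡_)
open import Function.Bundles using (_⇔_)

Name : Set
Name = ℕ

-- CPC patterns:  p ::= λx | x | ⌜x⌝ | p • p
infixr 6 _•_
data Pat : Set where
  bind : Name → Pat
  var  : Name → Pat
  prot : Name → Pat
  _•_  : Pat → Pat → Pat

vn pn bn fn : Pat → List Name
vn (bind x) = []
vn (var x)  = x ∷ []
vn (prot x) = []
vn (p • q)  = vn p ++ vn q
pn (bind x) = []
pn (var x)  = []
pn (prot x) = x ∷ []
pn (p • q)  = pn p ++ pn q
bn (bind x) = x ∷ []
bn (var x)  = []
bn (prot x) = []
bn (p • q)  = bn p ++ bn q
fn p = vn p ++ pn p

WellFormed : Pat → Set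
WellFormed p = Unique (bn p) × (∀ x → x ∈ bn p → x ∉ fn p)

data Communicable : Pat → Set where
  var : ∀ x → Communicable (var x)
  _•_ : ∀ {p q} → Communicable p → Communicable q → Communicable (p • q)

-- protection ⌜_⌝ of a communicable pattern:  ⌜x⌝ , ⌜p • q⌝ = ⌜p⌝ • ⌜q⌝
-- (only ever applied to communicable patterns; other clauses are irrelevant)
protect : Pat → Pat
protect (bind x) = bind x
protect (var x)  = prot x
protect (prot x) = prot x
protect (p • q)  = protect p • protect q

_∈dom_ : Name → (Name → Maybe Pat) → Set
x ∈dom m = MaybeAny (λ _ → ⊤) (m x)

record Subst : Set where
  field
    map    : Name → Maybe Pat
    finite : ∃ λ (xs : List Name) → ∀ x → x ∈dom map → x ∈ xs
    comm   : ∀ x p → map x ≡ just p → Communicable p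
open Subst public

apply : Subst → Pat → Pat
apply σ (bind x) = bind x
apply σ (var x) with map σ x
... | just p  = p
... | nothing = var x
apply σ (prot x) with map σ x
... | just p  = protect p
... | nothing = prot x
apply σ (p • q) = apply σ p • apply σ q

applyHat : Subst → Pat → Pat
applyHat σ (bind x) with map σ x
... | just p  = p
... | nothing = bind x
applyHat σ (var x)  = var x
applyHat σ (prot x) = prot x
applyHat σ (p • q)  = applyHat σ p • applyHat σ q

IsMatch : Pat → Subst → Set
IsMatch p σ = ∀ x → (x ∈ bn p) ⇔ (x ∈dom map σ)

_≐_ : (Name → Maybe Pat) → (Name → Maybe Pat) → Set
m ≐ m' = ∀ x → m x ≡ m' x

emptyMap : Name → Maybe Pat
emptyMap _ = nothing

singletonMap : Name → Pat → Name → Maybe Pat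
singletonMap y p x with x ≟ y
... | yes _ = just p
... | no _  = nothing

-- union of partial maps (used only for maps with disjoint domains)
_∪_ : (Name → Maybe Pat) → (Name → Maybe Pat) → Name → Maybe Pat
(m ∪ m') x with m x
... | just p  = just p
... | nothing = m' x

data _,_⋈_,_ : Pat → Subst → Pat → Subst → Set where
  bindR : ∀ {p σ y ρ} → fn p ≡ [] →
          map ρ ≐ singletonMap y (applyHat σ p) →
          p , σ ⋈ bind y , ρ
  varVar : ∀ {n σ ρ} → map σ ≐ emptyMap → map ρ ≐ emptyMap →
           var n , σ ⋈ var n , ρ
  protProt : ∀ {n σ ρ} → map σ ≐ emptyMap → map ρ ≐ emptyMap →
             prot n , σ ⋈ prot n , ρ
  protVar : ∀ {n σ ρ} → map σ ≐ emptyMap → map ρ ≐ emptyMap →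
            prot n , σ ⋈ var n , ρ
  comp : ∀ {p₁ p₂ q₁ q₂ σ ρ} (σ₁ σ₂ ρ₁ ρ₂ : Subst) →
         p₁ , σ₁ ⋈ q₁ , ρ₁ → p₂ , σ₂ ⋈ q₂ , ρ₂ →
         map σ ≐ (map σ₁ ∪ map σ₂) → map ρ ≐ (map ρ₁ ∪ map ρ₂) →
         (p₁ • p₂) , σ ⋈ (q₁ • q₂) , ρ

module Submission where

-- The statement only asks for SOME matches σ', ρ' of θp and θq, so the proof
-- builds them afresh by induction on the derivation of  p , σ ⋈ q , ρ :
--   * λy-case: p has no free names, hence is fixed by θ.  We match p with a
--     canonical substitution binding each of its binding names (to a variable),
--     so σ̂ p is communicable and  λy , {σ̂p/y}  is a legitimate match.
--   * name cases (x/x, ⌜x⌝/⌜x⌝, ⌜x⌝/x): θ sends a variable to a communicable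
--     pattern c and ⌜x⌝ to ⌜c⌝; communicable and protected-communicable patterns
--     have no binding names, match the empty substitution, and are compatible
--     componentwise (c/c, ⌜c⌝/⌜c⌝, ⌜c⌝/c).
--   * compound case: take the unions of the matches from the two components.

open import Defs
open import Data.Product using (Σ; _×_; _,_; proj₁; proj₂)
open import Data.Nat using (_≟_)
open import Data.List using ([]; _∷_; _++_)
open import Data.List.Properties using (++-conicalˡ; ++-conicalʳ)
open import Data.List.Membership.Propositional using (_∈_)
open import Data.List.Membership.Propositional.Properties using (∈-++⁺ˡ; ∈-++⁺ʳ; ∈-++⁻)
open import Data.List.Membership.DecPropositional _≟_ using (_∈?_)
open import Data.List.Relation.Unary.Any using (here)
open import Data.Maybe using (Maybe; just; nothing)
open import Data.Maybe.Relation.Unary.Any using (just)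
open import Data.Sum using (_⊎_; inj₁; inj₂)
open import Data.Unit using (tt)
open import Data.Empty using (⊥; ⊥-elim)
open import Relation.Nullary using (yes; no)
open import Relation.Binary.PropositionalEquality using (_≡_; refl; cong₂)
open import Function.Bundles using (mk⇔; Equivalence)

data Closed : Pat → Set where
  bind : ∀ x → Closed (bind x)
  _•_  : ∀ {a b} → Closed a → Closed b → Closed (a • b)

closed : ∀ r → vn r ≡ [] → pn r ≡ [] → Closed r
closed (bind x) _ _ = bind x
closed (a • b) v p =
  closed a (++-conicalˡ (vn a) (vn b) v) (++-conicalˡ (pn a) (pn b) p)
  • closed b (++-conicalʳ (vn a) (vn b) v) (++-conicalʳ (pn a) (pn b) p)

fn-empty⇒closed : ∀ r → fn r ≡ [] → Closed r
fn-empty⇒closed r e =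
  closed r (++-conicalˡ (vn r) (pn r) e) (++-conicalʳ (vn r) (pn r) e)

-- Substitution acts only on free names, so it fixes closed patterns.
apply-closed : ∀ θ {r} → Closed r → apply θ r ≡ r
apply-closed θ (bind x) = refl
apply-closed θ (a • b)  = cong₂ _•_ (apply-closed θ a) (apply-closed θ b)

∉dom : ∀ {m : Name → Maybe Pat} {x} → m x ≡ nothing → x ∈dom m → ⊥
∉dom {m} {x} e d with m x
∉dom refl () | nothing

emptyS : Subst
emptyS = record { map = emptyMap ; finite = [] , (λ _ ()) ; comm = λ _ _ () }

emptyMatch : ∀ r → bn r ≡ [] → IsMatch r emptyS
emptyMatch r e x rewrite e = mk⇔ (λ ()) (λ ())

∪-dom⁻ : ∀ (m m' : Name → Maybe Pat) x → x ∈dom (m ∪ m') → x ∈dom m ⊎ x ∈dom m'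
∪-dom⁻ m m' x d with m x
... | just _  = inj₁ (just tt)
... | nothing = inj₂ d

∪-dom⁺ : ∀ (m m' : Name → Maybe Pat) x → x ∈dom m ⊎ x ∈dom m' → x ∈dom (m ∪ m')
∪-dom⁺ m m' x d with m x
... | just _  = just tt
∪-dom⁺ m m' x (inj₂ d) | nothing = d

unionS : Subst → Subst → Subst
unionS s t = record
  { map    = map s ∪ map t
  ; finite = (proj₁ (finite s) ++ proj₁ (finite t)) , bounded
  ; comm   = communicable }
  where
  bounded : ∀ x → x ∈dom (map s ∪ map t) → x ∈ proj₁ (finite s) ++ proj₁ (finite t)
  bounded x d with ∪-dom⁻ (map s) (map t) x d
  ... | inj₁ a = ∈-++⁺ˡ (proj₂ (finite s) x a)
  ... | inj₂ b = ∈-++⁺ʳ (proj₁ (finite s)) (proj₂ (finite t) x b)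
  communicable : ∀ x p → (map s ∪ map t) x ≡ just p → Communicable p
  communicable x p e with map s x in eq
  communicable x p refl | just .p = comm s x p eq
  ... | nothing = comm t x p e

unionMatch : ∀ a b s t → IsMatch a s → IsMatch b t → IsMatch (a • b) (unionS s t)
unionMatch a b s t ms mt x = mk⇔ to from
  where
  to : x ∈ bn a ++ bn b → x ∈dom (map s ∪ map t)
  to i with ∈-++⁻ (bn a) i
  ... | inj₁ j = ∪-dom⁺ (map s) (map t) x (inj₁ (Equivalence.to (ms x) j))
  ... | inj₂ j = ∪-dom⁺ (map s) (map t) x (inj₂ (Equivalence.to (mt x) j))
  from : x ∈dom (map s ∪ map t) → x ∈ bn a ++ bn b
  from d with ∪-dom⁻ (map s) (map t) x d
  ... | inj₁ j = ∈-++⁺ˡ (Equivalence.from (ms x) j)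
  ... | inj₂ j = ∈-++⁺ʳ (bn a) (Equivalence.from (mt x) j)

singletonS : ∀ y c → Communicable c → Subst
singletonS y c cc = record
  { map = singletonMap y c ; finite = (y ∷ []) , bounded ; comm = communicable }
  where
  bounded : ∀ x → x ∈dom singletonMap y c → x ∈ y ∷ []
  bounded x d with x ≟ y
  ... | yes e = here e
  communicable : ∀ x p → singletonMap y c x ≡ just p → Communicable p
  communicable x p e with x ≟ y
  communicable x .c refl | yes _ = cc

singletonMatch : ∀ y c cc → IsMatch (bind y) (singletonS y c cc)
singletonMatch y c cc x = mk⇔ to from
  where
  to : x ∈ y ∷ [] → x ∈dom singletonMap y c
  to (here e) with x ≟ y
  ... | yes _ = just tt
  ... | no x≢y = ⊥-elim (x≢y e)
  from : x ∈dom singletonMap y c → x ∈ y ∷ []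
  from d with x ≟ y
  ... | yes e = here e

canonicalMap : Pat → Name → Maybe Pat
canonicalMap r x with x ∈? bn r
... | yes _ = just (var x)
... | no _  = nothing

canonicalS : Pat → Subst
canonicalS r = record
  { map = canonicalMap r ; finite = bn r , bounded ; comm = communicable }
  where
  bounded : ∀ x → x ∈dom canonicalMap r → x ∈ bn r
  bounded x d with x ∈? bn r
  ... | yes i = i
  communicable : ∀ x p → canonicalMap r x ≡ just p → Communicable p
  communicable x p e with x ∈? bn r
  communicable x .(var x) refl | yes _ = var x

canonicalMatch : ∀ r → IsMatch r (canonicalS r)
canonicalMatch r x = mk⇔ to (proj₂ (finite (canonicalS r)) x)
  where
  to : x ∈ bn r → x ∈dom canonicalMap r
  to i with x ∈? bn r
  ... | yes _  = just tt
  ... | no x∉ = ⊥-elim (x∉ i)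

-- σ̂ of a closed pattern is communicable when σ covers its binding names;
-- this makes {σ̂p/y} a substitution in the λy-rule.
hat-communicable : ∀ s {r} → Closed r → (∀ x → x ∈ bn r → x ∈dom map s) →
                   Communicable (applyHat s r)
hat-communicable s (bind x) covers with map s x in eq
... | just c  = comm s x c eq
... | nothing = ⊥-elim (∉dom {map s} eq (covers x (here refl)))
hat-communicable s (_•_ {a} ca cb) covers =
  hat-communicable s ca (λ x i → covers x (∈-++⁺ˡ i))
  • hat-communicable s cb (λ x i → covers x (∈-++⁺ʳ (bn a) i))

apply-var-communicable : ∀ θ n → Communicable (apply θ (var n))
apply-var-communicable θ n with map θ n in eq
... | just p  = comm θ n p eq
... | nothing = var n

apply-prot : ∀ θ n → apply θ (prot n) ≡ protect (apply θ (var n))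
apply-prot θ n with map θ n
... | just _  = refl
... | nothing = refl

bn-communicable : ∀ {c} → Communicable c → bn c ≡ []
bn-communicable (var x) = refl
bn-communicable (a • b) rewrite bn-communicable a | bn-communicable b = refl

bn-protect : ∀ {c} → Communicable c → bn (protect c) ≡ []
bn-protect (var x) = refl
bn-protect (a • b) rewrite bn-protect a | bn-protect b = refl

⋈-refl : ∀ {c} → Communicable c → c , emptyS ⋈ c , emptyS
⋈-refl (var x) = varVar (λ _ → refl) (λ _ → refl)
⋈-refl (a • b) = comp emptyS emptyS emptyS emptyS (⋈-refl a) (⋈-refl b) (λ _ → refl) (λ _ → refl)

⋈-protect-refl : ∀ {c} → Communicable c → protect c , emptyS ⋈ protect c , emptyS
⋈-protect-refl (var x) = protProt (λ _ → refl) (λ _ → refl)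
⋈-protect-refl (a • b) =
  comp emptyS emptyS emptyS emptyS (⋈-protect-refl a) (⋈-protect-refl b) (λ _ → refl) (λ _ → refl)

⋈-protect : ∀ {c} → Communicable c → protect c , emptyS ⋈ c , emptyS
⋈-protect (var x) = protVar (λ _ → refl) (λ _ → refl)
⋈-protect (a • b) = comp emptyS emptyS emptyS emptyS (⋈-protect a) (⋈-protect b) (λ _ → refl) (λ _ → refl)

Compatible : Pat → Pat → Set
Compatible a b = Σ Subst λ σ' → Σ Subst λ ρ' →
  IsMatch a σ' × IsMatch b ρ' × (a , σ' ⋈ b , ρ')

compatible-without-binders : ∀ {a b} → bn a ≡ [] → bn b ≡ [] →
                             a , emptyS ⋈ b , emptyS → Compatible a b
compatible-without-binders {a} {b} ea eb k =
  emptyS , emptyS , emptyMatch a ea , emptyMatch b eb , k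

⋈-apply : ∀ {p q σ ρ} → p , σ ⋈ q , ρ → (θ : Subst) → Compatible (apply θ p) (apply θ q)
⋈-apply {p} (bindR {y = y} fp _) θ rewrite apply-closed θ (fn-empty⇒closed p fp) =
  canonicalS p , singletonS y h hc , canonicalMatch p , singletonMatch y h hc ,
  bindR fp (λ _ → refl)
  where
  h : Pat
  h = applyHat (canonicalS p) p
  hc : Communicable h
  hc = hat-communicable (canonicalS p) (fn-empty⇒closed p fp)
         (λ x → Equivalence.to (canonicalMatch p x))
⋈-apply (varVar {n} _ _) θ =
  compatible-without-binders (bn-communicable c) (bn-communicable c) (⋈-refl c)
  where c : Communicable (apply θ (var n))
        c = apply-var-communicable θ n
⋈-apply (protProt {n} _ _) θ rewrite apply-prot θ n =
  compatible-without-binders (bn-protect c) (bn-protect c) (⋈-protect-refl c)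
  where c : Communicable (apply θ (var n))
        c = apply-var-communicable θ n
⋈-apply (protVar {n} _ _) θ rewrite apply-prot θ n =
  compatible-without-binders (bn-protect c) (bn-communicable c) (⋈-protect c)
  where c : Communicable (apply θ (var n))
        c = apply-var-communicable θ n
⋈-apply (comp {p₁} {p₂} {q₁} {q₂} _ _ _ _ k₁ k₂ _ _) θ
  with ⋈-apply k₁ θ | ⋈-apply k₂ θ
... | σ₁ , ρ₁ , mσ₁ , mρ₁ , k₁' | σ₂ , ρ₂ , mσ₂ , mρ₂ , k₂' =
  unionS σ₁ σ₂ , unionS ρ₁ ρ₂ ,
  unionMatch (apply θ p₁) (apply θ p₂) σ₁ σ₂ mσ₁ mσ₂ ,
  unionMatch (apply θ q₁) (apply θ q₂) ρ₁ ρ₂ mρ₁ mρ₂ ,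
  comp σ₁ σ₂ ρ₁ ρ₂ k₁' k₂' (λ _ → refl) (λ _ → refl)

-- Proposition 3.16.
proposition3p16 : (p q : Pat) (σ ρ : Subst) →
    WellFormed p → WellFormed q → IsMatch p σ → IsMatch q ρ →
    p , σ ⋈ q , ρ →
    (θ : Subst) →
    Σ Subst λ σ' → Σ Subst λ ρ' →
    IsMatch (apply θ p) σ' × IsMatch (apply θ q) ρ' × (apply θ p , σ' ⋈ apply θ q , ρ')
proposition3p16 p q σ ρ _ _ _ _ k θ = ⋈-apply k θ
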